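{- Let $M\ge 1$ and let $\mathcal{F}'$ be a simple family of subsets of $X=X_1\uplus\cdots\uplus X_M$ ($|X_i|=m_i$) which is an $M$-dimensional $M$-part Sperner family with parameter $L_{[M]}=1$, i.e. for any two distinct $E,F\in\mathcal{F}'$ there exists $j\in[M]$ such that neither of $E\cap X_j$, $F\cap X_j$ contains the other. Suppose $$\sum_{E\in\mathcal{F}'}\frac{1}{\prod_{i=1}^M\binom{m_i}{|E\cap X_i|}}=1.$$ Then for each $i\in[M]$ the trace $\mathcal{F}'_{X_i}=\{F\cap X_i:F\in\mathcal{F}'\}$ is a union of full levels of $2^{X_i}$, i.e. for every $q$, either every $q$-element subset of $X_i$ belongs to $\mathcal{F}'_{X_i}$ or none does. -}

module Defs where

open import Data.Nat using (ℕ; zero; suc)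
open import Data.Nat.Combinatorics using (_C_)
open import Data.Fin using (Fin)
open import Data.Fin.Subset using (Subset; _⊆_; ∣_∣)
open import Data.List using (List; map; foldr)
open import Data.Nat.ListAction using (product)
open import Data.List.Base using (allFin)
open import Data.List.Membership.Propositional using (_∈_)
open import Data.Integer using (+_)
open import Data.Rational using (ℚ; 0ℚ; _+_; _/_)
open import Data.Product using (Σ; ∃; _×_)
open import Relation.Binary.PropositionalEquality using (_≡_; _≢_)
open import Relation.Nullary using (¬_)

-- Ground set X = X_1 ⊎ ... ⊎ X_M with |X_i| = m i.
-- A subset E of X is given by its traces E ∩ X_i, one for each part.
SubsetX : (M : ℕ) → (Fin M → ℕ) → Set
SubsetX M m = (i : Fin M) → Subset (m i)

Distinct : ∀ {M m} → SubsetX M m → SubsetX M m → Set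
Distinct {M} E F = ∃ λ (i : Fin M) → E i ≢ F i

Incomparable : ∀ {n} → Subset n → Subset n → Set
Incomparable A B = (¬ (A ⊆ B)) × (¬ (B ⊆ A))

-- 1/n as a rational, with the convention 1/0 = 0 (only used for n ≥ 1).
inv : ℕ → ℚ
inv zero = 0ℚ
inv (suc n) = (+ 1) / suc n

weight : ∀ {M m} → SubsetX M m → ℚ
weight {M} {m} E = inv (product (map (λ i → m i C ∣ E i ∣) (allFin M)))

sumℚ : List ℚ → ℚ
sumℚ = foldr _+_ 0ℚ

InTrace : ∀ {M m} → List (SubsetX M m) → (i : Fin M) → Subset (m i) → Set
InTrace F' i S = ∃ λ E → (E ∈ F') × (E i ≡ S)

module Submission where

-- The proof double counts tuples of maximal chains, one maximal chain in
-- each part Xᵢ; there are ∏ mᵢ! of them.  A set E ⊆ X covers a chain tuple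
-- if each trace E ∩ Xᵢ lies on the i-th chain; E covers exactly
-- ∏ |E ∩ Xᵢ|! (mᵢ ∸ |E ∩ Xᵢ|)! tuples, the fraction weight E of all tuples.
--  (1) By the Sperner property each tuple has at most one cover in F'.
--  (2) If the weights sum to 1, the covers of all tuples add up to the
--      number of tuples, so every tuple has exactly one cover.
--  (3) Freezing the chains outside Xᵢ, the traces on Xᵢ of the covering
--      members meet every maximal chain of Xᵢ exactly once, and such a
--      family is a union of full levels: any two maximal chains are joined
--      by steps changing a single level.

open import Defs
open import Data.Bool.Properties using () renaming (_≟_ to _≟ᵇ_)
open import Data.Empty using (⊥-elim)
open import Data.Fin using (Fin; zero; suc; toℕ; fromℕ<; inject₁)
open import Data.Fin.Induction using (<-weakInduction)
open import Data.Fin.Properties using (toℕ-fromℕ<; toℕ-inject₁) renaming (_≟_ to _≟ᶠ_)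
open import Data.Fin.Subset using (Subset; inside; outside; ∣_∣; _⊆_)
open import Data.Fin.Subset.Properties using (out⊆; in⊆in; ⊆-antisym; ⊆-refl; ∣p∣≤n)
open import Data.Integer using (+_)
import Data.Integer as ℤ
import Data.Integer.Properties as ℤₚ
open import Data.List using (List; []; _∷_; map; tabulate)
open import Data.List.Base using (allFin)
open import Data.List.Properties using (map-tabulate)
open import Data.List.Membership.Propositional using (_∈_; find; lose)
open import Data.List.Relation.Binary.Subset.Propositional using () renaming (_⊆_ to _⊆ˡ_)
open import Data.List.Relation.Unary.All using (All; []; _∷_)
open import Data.List.Relation.Unary.AllPairs using (AllPairs; []; _∷_)
open import Data.List.Relation.Unary.Any using (here; there; any?)
open import Data.Nat using (ℕ; zero; suc; _+_; _*_; _∸_; _≤_; _<_; _≥_; z≤n; s≤s; s≤s⁻¹; _≤?_; _!; NonZero)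
open import Data.Nat.Combinatorics using (_C_; k![n∸k]!∣n!)
open import Data.Nat.Combinatorics.Specification using (nCk≡n!/k![n-k]!)
open import Data.Nat.DivMod using (m/n*n≡m)
open import Data.Nat.ListAction using (sum; product)
open import Data.Nat.Properties
open import Data.Product using (Σ; ∃; _×_; _,_; proj₁; proj₂; map₂)
open import Data.Rational using (1ℚ; toℚᵘ)
open import Data.Rational.Properties using (toℚᵘ-homo-+; toℚᵘ-fromℚᵘ)
open import Data.Rational.Unnormalised using (mkℚᵘ; *≡*; _≃_) renaming (_+_ to _+ᵘ_)
import Data.Rational.Unnormalised.Properties as ℚᵘ
open import Data.Sum using (_⊎_; inj₁; inj₂)
open import Data.Unit using (⊤; tt)
open import Data.Vec using ([]; _∷_)
open import Data.Vec.Properties using (≡-dec)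
open import Function using (_∘_; id; _⇔_; mk⇔; Equivalence)
open import Function.Properties.Equivalence using () renaming (sym to ⇔-sym)
open import Relation.Binary.Construct.Closure.ReflexiveTransitive using (Star; ε; _◅_; _◅◅_; gmap; reverse)
open import Relation.Binary.PropositionalEquality
open import Relation.Nullary using (¬_; Dec; yes; no)
open import Relation.Nullary.Decidable using (_×-dec_)
open import Algebra.Properties.CommutativeMonoid.Sum +-0-commutativeMonoid
  using () renaming (sum to ∑ᶠ; sum-cong-≗ to ∑ᶠ-cong; ∑-distrib-+ to ∑ᶠ-distrib-+)
open import Algebra.Properties.CommutativeMonoid.Sum *-1-commutativeMonoid
  using () renaming (sum to ∏; sum-cong-≗ to ∏-cong; ∑-distrib-+ to ∏-distrib-*; sum-replicate-zero to ∏-ones)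

open import Algebra.Properties.CommutativeSemigroup *-commutativeSemigroup using (x∙yz≈y∙xz)

open Equivalence using (to; from)

record Summation (A : Set) : Set where
  field
    ∑      : (A → ℕ) → ℕ
    ∑-cong : ∀ {f g : A → ℕ} → (∀ x → f x ≡ g x) → ∑ f ≡ ∑ g
    ∑-+    : ∀ (f g : A → ℕ) → ∑ (λ x → f x + g x) ≡ ∑ f + ∑ g
    ∑≡0    : ∀ (f : A → ℕ) → ∑ f ≡ 0 → ∀ x → f x ≡ 0

  -- Summing zero gives zero: ∑ 0 = ∑ (0 + 0) = ∑ 0 + ∑ 0 forces ∑ 0 = 0.
  ∑-zero : ∑ (λ _ → 0) ≡ 0
  ∑-zero = +-cancelˡ-≡ z z 0 (trans (sym (∑-+ _ _)) (sym (+-identityʳ z)))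
    where z = ∑ (λ _ → 0)

  ∑-*ˡ : ∀ k (f : A → ℕ) → ∑ (λ x → k * f x) ≡ k * ∑ f
  ∑-*ˡ zero    f = ∑-zero
  ∑-*ˡ (suc k) f = trans (∑-+ f (λ x → k * f x)) (cong (_+_ (∑ f)) (∑-*ˡ k f))

  ∑-*ʳ : ∀ k (f : A → ℕ) → ∑ (λ x → f x * k) ≡ ∑ f * k
  ∑-*ʳ k f = trans (∑-cong (λ x → *-comm (f x) k)) (trans (∑-*ˡ k f) (*-comm k (∑ f)))

  -- If f ≤ g pointwise and the totals agree, then f = g: the excess g ∸ f
  -- has total zero, hence vanishes everywhere by positivity.
  ∑-tight : ∀ {f g : A → ℕ} → (∀ x → f x ≤ g x) → ∑ f ≡ ∑ g → ∀ x → f x ≡ g x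
  ∑-tight {f} {g} f≤g ∑f≡∑g x =
    ≤-antisym (f≤g x) (m∸n≡0⇒m≤n (∑≡0 excess ∑excess≡0 x))
    where
    excess : A → ℕ
    excess y = g y ∸ f y

    ∑excess≡0 : ∑ excess ≡ 0
    ∑excess≡0 = +-cancelˡ-≡ (∑ f) (∑ excess) 0 (begin
      ∑ f + ∑ excess                  ≡⟨ ∑-+ f excess ⟨
      ∑ (λ y → f y + (g y ∸ f y))     ≡⟨ ∑-cong (λ y → m+[n∸m]≡n (f≤g y)) ⟩
      ∑ g                             ≡⟨ ∑f≡∑g ⟨
      ∑ f                             ≡⟨ +-identityʳ (∑ f) ⟨
      ∑ f + 0                         ∎)
      where open ≡-Reasoning

open Summation public

⊤-summation : Summation ⊤
⊤-summation = record
  { ∑      = λ f → f tt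
  ; ∑-cong = λ f≗g → f≗g tt
  ; ∑-+    = λ f g → refl
  ; ∑≡0    = λ { f ∑f≡0 tt → ∑f≡0 }
  }

Fin-summation : ∀ n → Summation (Fin n)
Fin-summation n = record
  { ∑      = ∑ᶠ
  ; ∑-cong = ∑ᶠ-cong
  ; ∑-+    = ∑ᶠ-distrib-+
  ; ∑≡0    = ∑ᶠ≡0
  }
  where
  ∑ᶠ≡0 : ∀ {n} (f : Fin n → ℕ) → ∑ᶠ f ≡ 0 → ∀ x → f x ≡ 0
  ∑ᶠ≡0 f ∑f≡0 zero    = m+n≡0⇒m≡0 (f zero) ∑f≡0
  ∑ᶠ≡0 f ∑f≡0 (suc x) = ∑ᶠ≡0 (λ y → f (suc y)) (m+n≡0⇒n≡0 (f zero) ∑f≡0) x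

_×ₛ_ : ∀ {A B : Set} → Summation A → Summation B → Summation (A × B)
S ×ₛ T = record
  { ∑      = λ f → ∑ S (λ a → ∑ T (λ b → f (a , b)))
  ; ∑-cong = λ f≗g → ∑-cong S (λ a → ∑-cong T (λ b → f≗g (a , b)))
  ; ∑-+    = λ f g → trans (∑-cong S (λ a → ∑-+ T (λ b → f (a , b)) (λ b → g (a , b))))
                           (∑-+ S _ _)
  ; ∑≡0    = λ { f ∑f≡0 (a , b) → ∑≡0 T (λ b → f (a , b)) (∑≡0 S _ ∑f≡0 a) b }
  }

∑-× : ∀ {A B : Set} (S : Summation A) (T : Summation B) (f : A → ℕ) (g : B → ℕ) →
      ∑ (S ×ₛ T) (λ { (a , b) → f a * g b }) ≡ ∑ S f * ∑ T g
∑-× S T f g = trans (∑-cong S (λ a → ∑-*ˡ T (f a) g)) (∑-*ʳ S (∑ T g) f)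

∑-Fin-ones : ∀ n → ∑ (Fin-summation n) (λ _ → 1) ≡ n
∑-Fin-ones zero    = refl
∑-Fin-ones (suc n) = cong suc (∑-Fin-ones n)

product-tabulate : ∀ {M} (h : Fin M → ℕ) → product (tabulate h) ≡ ∏ h
product-tabulate {zero}  h = refl
product-tabulate {suc M} h = cong (h zero *_) (product-tabulate (h ∘ suc))

∏-nonZero : ∀ {M} (h : Fin M → ℕ) → (∀ i → NonZero (h i)) → NonZero (∏ h)
∏-nonZero {zero}  h _  = _
∏-nonZero {suc M} h nz =
  m*n≢0 (h zero) (∏ (h ∘ suc)) {{nz zero}} {{∏-nonZero (h ∘ suc) (nz ∘ suc)}}

∏≤1 : ∀ {M} (h : Fin M → ℕ) → (∀ i → h i ≤ 1) → ∏ h ≤ 1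
∏≤1 {zero}  h _    = ≤-refl
∏≤1 {suc M} h h≤1 = *-mono-≤ (h≤1 zero) (∏≤1 (h ∘ suc) (h≤1 ∘ suc))

∏≢0 : ∀ {M} (h : Fin M → ℕ) → ∏ h ≢ 0 → ∀ i → h i ≢ 0
∏≢0 {suc M} h ∏h≢0 zero    h₀≡0 = ∏h≢0 (cong (_* ∏ (h ∘ suc)) h₀≡0)
∏≢0 {suc M} h ∏h≢0 (suc i) = ∏≢0 (h ∘ suc) ∏rest≢0 i
  where
  ∏rest≢0 : ∏ (h ∘ suc) ≢ 0
  ∏rest≢0 ∏rest≡0 = ∏h≢0 (trans (cong (h zero *_) ∏rest≡0) (*-zeroʳ (h zero)))

χ : ∀ {P : Set} → Dec P → ℕ
χ (yes _) = 1
χ (no _)  = 0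

χ-× : ∀ {P Q : Set} (p : Dec P) (q : Dec Q) → χ (p ×-dec q) ≡ χ p * χ q
χ-× (yes _) (yes _) = refl
χ-× (yes _) (no _)  = refl
χ-× (no _)  _       = refl

χ-cong : ∀ {P Q : Set} (p : Dec P) (q : Dec Q) → (P → Q) → (Q → P) → χ p ≡ χ q
χ-cong (yes _) (yes _) _   _   = refl
χ-cong (yes x) (no ¬y) P→Q _   = ⊥-elim (¬y (P→Q x))
χ-cong (no ¬x) (yes y) _   Q→P = ⊥-elim (¬x (Q→P y))
χ-cong (no _)  (no _)  _   _   = refl

χ≤1 : ∀ {P : Set} (p : Dec P) → χ p ≤ 1
χ≤1 (yes _) = s≤s z≤n
χ≤1 (no _)  = z≤n

χ≢0 : ∀ {P : Set} (p : Dec P) → χ p ≢ 0 → P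
χ≢0 (yes x) _       = x
χ≢0 (no _)  nonzero = ⊥-elim (nonzero refl)

count-≤ : ∀ n r → r < n → ∑ (Fin-summation n) (λ p → χ (toℕ p ≤? r)) ≡ suc r
count-≤ (suc n) zero    _         = cong suc (∑-zero (Fin-summation n))
count-≤ (suc n) (suc r) (s≤s r<n) = cong suc (trans
  (∑-cong (Fin-summation n) (λ p → χ-cong (suc (toℕ p) ≤? suc r) (toℕ p ≤? r) s≤s⁻¹ s≤s))
  (count-≤ n r r<n))

count-≥ : ∀ n r → ∑ (Fin-summation n) (λ p → χ (r ≤? toℕ p)) ≡ n ∸ r
count-≥ zero    r       = sym (0∸n≡0 r)
count-≥ (suc n) zero    = cong suc (∑-Fin-ones n)
count-≥ (suc n) (suc r) = trans
  (∑-cong (Fin-summation n) (λ p → χ-cong (suc r ≤? suc (toℕ p)) (r ≤? toℕ p) s≤s⁻¹ s≤s))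
  (count-≥ n r)

-- A maximal chain of subsets of an m-set is an order in which its elements
-- are added.  We encode it recursively: a chain on m + 1 elements records
-- the number p ≤ m of other elements added before the first element,
-- together with a chain on the remaining m elements.
Chain : ℕ → Set
Chain zero    = ⊤
Chain (suc m) = Fin (suc m) × Chain m

chain-summation : ∀ m → Summation (Chain m)
chain-summation zero    = ⊤-summation
chain-summation (suc m) = Fin-summation (suc m) ×ₛ chain-summation m

∑-chain-ones : ∀ m → ∑ (chain-summation m) (λ _ → 1) ≡ m !
∑-chain-ones zero    = refl
∑-chain-ones (suc m) =
  trans (∑-× (Fin-summation (suc m)) (chain-summation m) (λ _ → 1) (λ _ → 1))
        (cong₂ _*_ (∑-Fin-ones (suc m)) (∑-chain-ones m))

-- S lies on the chain (p , c) iff its remainder R lies on c and the first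
-- element belongs to S exactly when it is added among the first |S| elements.
OnChain : ∀ {m} → Subset m → Chain m → Set
OnChain []            _       = ⊤
OnChain (inside ∷ R)  (p , c) = toℕ p ≤ ∣ R ∣ × OnChain R c
OnChain (outside ∷ R) (p , c) = ∣ R ∣ ≤ toℕ p × OnChain R c

onChain? : ∀ {m} (S : Subset m) (c : Chain m) → Dec (OnChain S c)
onChain? []            _       = yes tt
onChain? (inside ∷ R)  (p , c) = (toℕ p ≤? ∣ R ∣) ×-dec onChain? R c
onChain? (outside ∷ R) (p , c) = (∣ R ∣ ≤? toℕ p) ×-dec onChain? R c

onChain-⊆ : ∀ {m} (S T : Subset m) {c : Chain m} →
            OnChain S c → OnChain T c → ∣ S ∣ ≤ ∣ T ∣ → S ⊆ T
onChain-⊆ []            []            _            _            _         = ⊆-refl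
onChain-⊆ (inside ∷ R)  (inside ∷ R')  (_ , R∈c)    (_ , R'∈c)    (s≤s R≤R') =
  in⊆in (onChain-⊆ R R' R∈c R'∈c R≤R')
onChain-⊆ (outside ∷ R) (outside ∷ R') (_ , R∈c)    (_ , R'∈c)    R≤R'       =
  out⊆ (onChain-⊆ R R' R∈c R'∈c R≤R')
onChain-⊆ (outside ∷ R) (inside ∷ R')  (R≤p , R∈c)  (p≤R' , R'∈c) _          =
  out⊆ (onChain-⊆ R R' R∈c R'∈c (≤-trans R≤p p≤R'))
onChain-⊆ (inside ∷ R)  (outside ∷ R') (p≤R , _)    (R'≤p , _)    R<R'       =
  ⊥-elim (<⇒≱ R<R' (≤-trans R'≤p p≤R))

onChain-comparable : ∀ {m} {S T : Subset m} {c : Chain m} →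
                     OnChain S c → OnChain T c → S ⊆ T ⊎ T ⊆ S
onChain-comparable {S = S} {T} S∈c T∈c with ≤-total ∣ S ∣ ∣ T ∣
... | inj₁ S≤T = inj₁ (onChain-⊆ S T S∈c T∈c S≤T)
... | inj₂ T≤S = inj₂ (onChain-⊆ T S T∈c S∈c T≤S)

onChain-unique : ∀ {m} {S T : Subset m} {c : Chain m} →
                 OnChain S c → OnChain T c → ∣ S ∣ ≡ ∣ T ∣ → S ≡ T
onChain-unique {S = S} {T} S∈c T∈c |S|≡|T| =
  ⊆-antisym (onChain-⊆ S T S∈c T∈c (≤-reflexive |S|≡|T|))
            (onChain-⊆ T S T∈c S∈c (≤-reflexive (sym |S|≡|T|)))

empty-onChain : ∀ {m} (R : Subset m) (c : Chain m) → ∣ R ∣ ≤ 0 → OnChain R c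
empty-onChain []            _       _    = tt
empty-onChain (outside ∷ R) (_ , c) R≤0  = ≤-trans R≤0 z≤n , empty-onChain R c R≤0

chainThrough : ∀ {m} (S : Subset m) → Σ (Chain m) (OnChain S)
chainThrough []            = tt , tt
chainThrough (inside ∷ R)  with chainThrough R
... | c , R∈c = (fromℕ< (s≤s (∣p∣≤n R)) , c) , ≤-reflexive (toℕ-fromℕ< _) , R∈c
chainThrough (outside ∷ R) with chainThrough R
... | c , R∈c = (fromℕ< (s≤s (∣p∣≤n R)) , c) , ≤-reflexive (sym (toℕ-fromℕ< _)) , R∈c

∑-onChain-step : ∀ m {P : Fin (suc m) → Set} (P? : ∀ p → Dec (P p)) (R : Subset m) →
  ∑ (chain-summation (suc m)) (λ (p , c) → χ (P? p ×-dec onChain? R c))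
    ≡ ∑ (Fin-summation (suc m)) (χ ∘ P?) * ∑ (chain-summation m) (λ c → χ (onChain? R c))
∑-onChain-step m P? R =
  trans (∑-cong (chain-summation (suc m)) (λ (p , c) → χ-× (P? p) (onChain? R c)))
        (∑-× (Fin-summation (suc m)) (chain-summation m) (χ ∘ P?) (λ c → χ (onChain? R c)))

∑-onChain : ∀ m (S : Subset m) →
            ∑ (chain-summation m) (λ c → χ (onChain? S c)) ≡ ∣ S ∣ ! * (m ∸ ∣ S ∣) !
∑-onChain zero    []            = refl
∑-onChain (suc m) (inside ∷ R)  = begin
  ∑ (chain-summation (suc m)) (λ c → χ (onChain? (inside ∷ R) c))
    ≡⟨ ∑-onChain-step m (λ p → toℕ p ≤? ∣ R ∣) R ⟩
  ∑ (Fin-summation (suc m)) (λ p → χ (toℕ p ≤? ∣ R ∣)) * ∑ (chain-summation m) (λ c → χ (onChain? R c))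
    ≡⟨ cong₂ _*_ (count-≤ (suc m) ∣ R ∣ (s≤s (∣p∣≤n R))) (∑-onChain m R) ⟩
  suc ∣ R ∣ * (∣ R ∣ ! * (m ∸ ∣ R ∣) !)
    ≡⟨ *-assoc (suc ∣ R ∣) (∣ R ∣ !) _ ⟨
  suc ∣ R ∣ ! * (m ∸ ∣ R ∣) ! ∎
  where open ≡-Reasoning
∑-onChain (suc m) (outside ∷ R) = begin
  ∑ (chain-summation (suc m)) (λ c → χ (onChain? (outside ∷ R) c))
    ≡⟨ ∑-onChain-step m (λ p → ∣ R ∣ ≤? toℕ p) R ⟩
  ∑ (Fin-summation (suc m)) (λ p → χ (∣ R ∣ ≤? toℕ p)) * ∑ (chain-summation m) (λ c → χ (onChain? R c))
    ≡⟨ cong₂ _*_ (trans (count-≥ (suc m) ∣ R ∣) 1+m∸R) (∑-onChain m R) ⟩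
  suc (m ∸ ∣ R ∣) * (∣ R ∣ ! * (m ∸ ∣ R ∣) !)
    ≡⟨ x∙yz≈y∙xz (suc (m ∸ ∣ R ∣)) (∣ R ∣ !) _ ⟩
  ∣ R ∣ ! * suc (m ∸ ∣ R ∣) !
    ≡⟨ cong (λ k → ∣ R ∣ ! * k !) 1+m∸R ⟨
  ∣ R ∣ ! * (suc m ∸ ∣ R ∣) ! ∎
  where
  open ≡-Reasoning
  1+m∸R : suc m ∸ ∣ R ∣ ≡ suc (m ∸ ∣ R ∣)
  1+m∸R = +-∸-assoc 1 (∣p∣≤n R)

Adjacent : ∀ {m} → Chain m → Chain m → Set
Adjacent {m} c c' = ∃ λ ℓ → ∀ (S : Subset m) → ∣ S ∣ ≢ ℓ → OnChain S c ⇔ OnChain S c'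

adjacent-sym : ∀ {m} {c c' : Chain m} → Adjacent c c' → Adjacent c' c
adjacent-sym (ℓ , same) = ℓ , λ S |S|≢ℓ → ⇔-sym (same S |S|≢ℓ)

adjacent-lift : ∀ {m} {c c' : Chain m} → Adjacent c c' → Adjacent {suc m} (zero , c) (zero , c')
adjacent-lift {c = c} {c'} (ℓ , same) = suc ℓ , same'
  where
  same' : ∀ S → ∣ S ∣ ≢ suc ℓ → OnChain S (zero , c) ⇔ OnChain S (zero , c')
  same' (inside ∷ R)  |S|≢1+ℓ = mk⇔ (map₂ (to R∈c⇔R∈c')) (map₂ (from R∈c⇔R∈c'))
    where R∈c⇔R∈c' = same R (|S|≢1+ℓ ∘ cong suc)
  same' (outside ∷ R) _       = mk⇔ (λ (R≤0 , _) → R≤0 , empty-onChain R c' R≤0)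
                                    (λ (R≤0 , _) → R≤0 , empty-onChain R c R≤0)

adjacent-step : ∀ {m} (p : Fin m) (c : Chain m) → Adjacent {suc m} (suc p , c) (inject₁ p , c)
adjacent-step p c = suc (toℕ p) , same
  where
  p′≡p : toℕ (inject₁ p) ≡ toℕ p
  p′≡p = toℕ-inject₁ p
  same : ∀ S → ∣ S ∣ ≢ suc (toℕ p) → OnChain S (suc p , c) ⇔ OnChain S (inject₁ p , c)
  same (inside ∷ R)  |S|≢1+p = mk⇔
    (λ (p<R , R∈c) → subst (_≤ ∣ R ∣) (sym p′≡p) (≤-trans (n≤1+n _) p<R) , R∈c)
    (λ (p≤R , R∈c) → ≤∧≢⇒< (subst (_≤ ∣ R ∣) p′≡p p≤R) (|S|≢1+p ∘ cong suc ∘ sym) , R∈c)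
  same (outside ∷ R) |S|≢1+p = mk⇔
    (λ (R≤1+p , R∈c) → subst (∣ R ∣ ≤_) (sym p′≡p) (s≤s⁻¹ (≤∧≢⇒< R≤1+p |S|≢1+p)) , R∈c)
    (λ (R≤p , R∈c) → ≤-trans (subst (∣ R ∣ ≤_) p′≡p R≤p) (n≤1+n _) , R∈c)

canonical : ∀ m → Chain m
canonical zero    = _
canonical (suc m) = zero , canonical m

-- Any two maximal chains are connected by a path of adjacent chains:
-- move the first element to the front step by step, then recurse.
connected : ∀ {m} (c : Chain m) → Star Adjacent c (canonical m)
connected {zero}  _       = ε
connected {suc m} (p , c) = toFront p ◅◅ gmap (zero ,_) adjacent-lift (connected c)
  where
  toFront : ∀ p → Star Adjacent (p , c) (zero , c)
  toFront = <-weakInduction (λ p → Star Adjacent (p , c) (zero , c)) ε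
                            (λ p path → adjacent-step p c ◅ path)

module FullLevels {m} (G : Subset m → Set)
  (at-most-one  : ∀ {S T c} → G S → G T → OnChain S c → OnChain T c → S ≡ T)
  (at-least-one : ∀ c → ∃ λ S → G S × OnChain S c) where

  MeetsAt : Chain m → ℕ → Set
  MeetsAt c k = ∃ λ S → G S × OnChain S c × ∣ S ∣ ≡ k

  -- If c meets G at size k, so does an adjacent chain c': either the set met
  -- is not at the changed level ℓ and stays on c', or it is, and then the
  -- set met by c' also has size ℓ, since otherwise it would lie on c too.
  meetsAt-adjacent : ∀ {c c' k} → Adjacent c c' → MeetsAt c k → MeetsAt c' k
  meetsAt-adjacent (ℓ , same) (S , S∈G , S∈c , |S|≡k) with ∣ S ∣ ≟ ℓ
  ... | no |S|≢ℓ = S , S∈G , to (same S |S|≢ℓ) S∈c , |S|≡k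
  ... | yes |S|≡ℓ with at-least-one _
  ...   | T , T∈G , T∈c' with ∣ T ∣ ≟ ℓ
  ...     | yes |T|≡ℓ = T , T∈G , T∈c' , trans |T|≡ℓ (trans (sym |S|≡ℓ) |S|≡k)
  ...     | no |T|≢ℓ  = T , T∈G , T∈c' ,
                        trans (cong ∣_∣ (at-most-one T∈G S∈G (from (same T |T|≢ℓ) T∈c') S∈c)) |S|≡k

  meetsAt-connected : ∀ {c c' k} → Star Adjacent c c' → MeetsAt c k → MeetsAt c' k
  meetsAt-connected ε            = id
  meetsAt-connected (step ◅ path) = meetsAt-connected path ∘ meetsAt-adjacent step

  -- … so, all chains being connected, G contains every set of the size of
  -- any of its members: walk from a chain through S to one through S'.
  full-levels : ∀ {S S'} → G S → ∣ S' ∣ ≡ ∣ S ∣ → G S'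
  full-levels {S} {S'} S∈G |S'|≡|S| =
    let c  , S∈c  = chainThrough S
        c' , S'∈c' = chainThrough S'
        path = connected c ◅◅ reverse adjacent-sym (connected c')
        T , T∈G , T∈c' , |T|≡|S| = meetsAt-connected path (S , S∈G , S∈c , refl)
    in subst G (onChain-unique T∈c' S'∈c' (trans |T|≡|S| (sym |S'|≡|S|))) T∈G

Tuple : (M : ℕ) → (Fin M → Set) → Set
Tuple zero    A = ⊤
Tuple (suc M) A = A zero × Tuple M (A ∘ suc)

get : ∀ {M} {A : Fin M → Set} → Tuple M A → (i : Fin M) → A i
get {suc M} (a , t) zero    = a
get {suc M} (a , t) (suc i) = get t i

set : ∀ {M} {A : Fin M → Set} → Tuple M A → (i : Fin M) → A i → Tuple M A
set {suc M} (a , t) zero    b = b , t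
set {suc M} (a , t) (suc i) b = a , set t i b

get-set-same : ∀ {M} {A : Fin M → Set} (t : Tuple M A) i b → get (set t i b) i ≡ b
get-set-same {suc M} (a , t) zero    b = refl
get-set-same {suc M} (a , t) (suc i) b = get-set-same t i b

get-set-other : ∀ {M} {A : Fin M → Set} (t : Tuple M A) i b j → i ≢ j → get (set t i b) j ≡ get t j
get-set-other {suc M} (a , t) zero    b zero    i≢j = ⊥-elim (i≢j refl)
get-set-other {suc M} (a , t) zero    b (suc j) _   = refl
get-set-other {suc M} (a , t) (suc i) b zero    _   = refl
get-set-other {suc M} (a , t) (suc i) b (suc j) i≢j = get-set-other t i b j (i≢j ∘ cong suc)

tuple : ∀ {M} {A : Fin M → Set} → ((i : Fin M) → A i) → Tuple M A
tuple {zero}  f = tt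
tuple {suc M} f = f zero , tuple (f ∘ suc)

get-tuple : ∀ {M} {A : Fin M → Set} (f : (i : Fin M) → A i) i → get (tuple f) i ≡ f i
get-tuple {suc M} f zero    = refl
get-tuple {suc M} f (suc i) = get-tuple (f ∘ suc) i

tuple-summation : ∀ {M} {A : Fin M → Set} → (∀ i → Summation (A i)) → Summation (Tuple M A)
tuple-summation {zero}  S = ⊤-summation
tuple-summation {suc M} S = S zero ×ₛ tuple-summation (S ∘ suc)

∑-∏ : ∀ {M} {A : Fin M → Set} (S : ∀ i → Summation (A i)) (g : ∀ i → A i → ℕ) →
      ∑ (tuple-summation S) (λ t → ∏ (λ i → g i (get t i))) ≡ ∏ (λ i → ∑ (S i) (g i))
∑-∏ {zero}  S g = refl
∑-∏ {suc M} S g = trans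
  (∑-× (S zero) (tuple-summation (S ∘ suc)) (g zero) (λ t → ∏ (λ i → g (suc i) (get t i))))
  (cong (∑ (S zero) (g zero) *_) (∑-∏ (S ∘ suc) (g ∘ suc)))

same-denominator-+ : ∀ a b d → mkℚᵘ (+ a) d +ᵘ mkℚᵘ (+ b) d ≃ mkℚᵘ (+ (a + b)) d
same-denominator-+ a b d =
  *≡* (trans (cong (ℤ._* + D) (sym (ℤₚ.*-distribʳ-+ (+ D) (+ a) (+ b))))
             (ℤₚ.*-assoc (+ (a + b)) (+ D) (+ D)))
  where D = suc d

reciprocal : ∀ p v d → p * v ≡ suc d → toℚᵘ (inv p) ≃ mkℚᵘ (+ v) d
reciprocal (suc k) v d pv≡D =
  ℚᵘ.≃-trans (toℚᵘ-fromℚᵘ (mkℚᵘ (+ 1) k))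
          (*≡* (trans (cong +_ (trans (+-identityʳ (suc d)) (trans (sym pv≡D) (*-comm (suc k) v))))
                      (ℤₚ.pos-* v (suc k))))

reciprocal-sum : ∀ {X : Set} (p v : X → ℕ) d → (∀ x → p x * v x ≡ suc d) →
                 ∀ l → toℚᵘ (sumℚ (map (inv ∘ p) l)) ≃ mkℚᵘ (+ sum (map v l)) d
reciprocal-sum p v d pv≡D []      = *≡* refl
reciprocal-sum p v d pv≡D (x ∷ l) =
  ℚᵘ.≃-trans (toℚᵘ-homo-+ (inv (p x)) (sumℚ (map (inv ∘ p) l)))
  (ℚᵘ.≃-trans (ℚᵘ.+-cong (reciprocal (p x) (v x) d (pv≡D x)) (reciprocal-sum p v d pv≡D l))
           (same-denominator-+ (v x) (sum (map v l)) d))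

reciprocals-sum-to-one : ∀ {X : Set} (p v : X → ℕ) D .{{_ : NonZero D}} → (∀ x → p x * v x ≡ D) →
                         ∀ l → sumℚ (map (inv ∘ p) l) ≡ 1ℚ → sum (map v l) ≡ D
reciprocals-sum-to-one p v (suc d) pv≡D l ∑≡1
  with *≡* eq ← subst (λ q → toℚᵘ q ≃ mkℚᵘ (+ sum (map v l)) d) ∑≡1 (reciprocal-sum p v d pv≡D l) =
  sym (trans (sym (+-identityʳ (suc d))) (ℤₚ.+-injective (trans eq (ℤₚ.*-identityʳ _))))

binomial-factorials : ∀ n k → k ≤ n → (n C k) * (k ! * (n ∸ k) !) ≡ n !
binomial-factorials n k k≤n =
  trans (cong (_* (k ! * (n ∸ k) !)) (nCk≡n!/k![n-k]! k≤n))
        (m/n*n≡m {{k !* (n ∸ k) !≢0}} (k![n∸k]!∣n! k≤n))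

module ChainCounting {M : ℕ} (m : Fin M → ℕ) where

  ChainTuple : Set
  ChainTuple = Tuple M (Chain ∘ m)

  chainTuples : Summation ChainTuple
  chainTuples = tuple-summation (chain-summation ∘ m)

  totalChains : ℕ
  totalChains = ∏ (λ i → m i !)

  chainsThrough : SubsetX M m → ℕ
  chainsThrough E = ∏ (λ i → ∣ E i ∣ ! * (m i ∸ ∣ E i ∣) !)

  binomials : SubsetX M m → ℕ
  binomials E = product (map (λ i → m i C ∣ E i ∣) (allFin M))

  instance
    totalChains-nonZero : NonZero totalChains
    totalChains-nonZero = ∏-nonZero (λ i → m i !) (λ i → m i !≢0)

  binomials*chainsThrough : ∀ E → binomials E * chainsThrough E ≡ totalChains
  binomials*chainsThrough E = begin
    product (map binom (allFin M)) * chainsThrough E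
      ≡⟨ cong (_* chainsThrough E) (trans (cong product (map-tabulate id binom))
                                          (product-tabulate binom)) ⟩
    ∏ binom * chainsThrough E
      ≡⟨ ∏-distrib-* binom _ ⟨
    ∏ (λ i → binom i * (∣ E i ∣ ! * (m i ∸ ∣ E i ∣) !))
      ≡⟨ ∏-cong (λ i → binomial-factorials (m i) ∣ E i ∣ (∣p∣≤n (E i))) ⟩
    totalChains ∎
    where
    open ≡-Reasoning
    binom : Fin M → ℕ
    binom i = m i C ∣ E i ∣

  ∑-ones : ∑ chainTuples (λ _ → 1) ≡ totalChains
  ∑-ones = begin
    ∑ chainTuples (λ _ → 1)                       ≡⟨ ∑-cong chainTuples (λ _ → ∏-ones M) ⟨
    ∑ chainTuples (λ _ → ∏ {M} (λ _ → 1))         ≡⟨ ∑-∏ (chain-summation ∘ m) (λ _ _ → 1) ⟩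
    ∏ (λ i → ∑ (chain-summation (m i)) (λ _ → 1)) ≡⟨ ∏-cong (λ i → ∑-chain-ones (m i)) ⟩
    totalChains                                   ∎
    where open ≡-Reasoning

  Covers : SubsetX M m → ChainTuple → Set
  Covers E t = ∀ i → OnChain (E i) (get t i)

  covers# : SubsetX M m → ChainTuple → ℕ
  covers# E t = ∏ (λ i → χ (onChain? (E i) (get t i)))

  covers#≤1 : ∀ E t → covers# E t ≤ 1
  covers#≤1 E t = ∏≤1 _ (λ i → χ≤1 (onChain? (E i) (get t i)))

  covers#≢0 : ∀ {E t} → covers# E t ≢ 0 → Covers E t
  covers#≢0 {E} {t} c≢0 i = χ≢0 (onChain? (E i) (get t i)) (∏≢0 _ c≢0 i)

  ∑-covers# : ∀ E → ∑ chainTuples (covers# E) ≡ chainsThrough E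
  ∑-covers# E = trans (∑-∏ (chain-summation ∘ m) (λ i c → χ (onChain? (E i) c)))
                      (∏-cong (λ i → ∑-onChain (m i) (E i)))

  coverCount : List (SubsetX M m) → ChainTuple → ℕ
  coverCount l t = sum (map (λ E → covers# E t) l)

  ∑-coverCount : ∀ l → ∑ chainTuples (coverCount l) ≡ sum (map chainsThrough l)
  ∑-coverCount []      = ∑-zero chainTuples
  ∑-coverCount (E ∷ l) = trans (∑-+ chainTuples (covers# E) (coverCount l))
                               (cong₂ _+_ (∑-covers# E) (∑-coverCount l))

  coverCount≢0 : ∀ l t → coverCount l t ≢ 0 → ∃ λ E → E ∈ l × Covers E t
  coverCount≢0 []      t c≢0 = ⊥-elim (c≢0 refl)
  coverCount≢0 (E ∷ l) t c≢0 with covers# E t ≟ 0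
  ... | no  E-covers  = E , here refl , covers#≢0 E-covers
  ... | yes E-misses with coverCount≢0 l t (c≢0 ∘ trans (cong (_+ coverCount l t) E-misses))
  ...   | F , F∈l , F-covers = F , there F∈l , F-covers

module Sperner {M : ℕ} {m : Fin M → ℕ} (F' : List (SubsetX M m))
  (sperner : ∀ E F → E ∈ F' → F ∈ F' → Distinct E F → ∃ λ j → Incomparable (E j) (F j)) where

  open ChainCounting m

  -- Two members covering a common chain tuple coincide: if they differed,
  -- they would be incomparable in some part, yet their traces there lie on
  -- a common chain.
  unique-cover : ∀ {E F t} → E ∈ F' → F ∈ F' → Covers E t → Covers F t → ∀ i → E i ≡ F i
  unique-cover {E} {F} E∈F' F∈F' E-covers F-covers i with ≡-dec _≟ᵇ_ (E i) (F i)
  ... | yes Eᵢ≡Fᵢ = Eᵢ≡Fᵢ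
  ... | no  Eᵢ≢Fᵢ with sperner E F E∈F' F∈F' (i , Eᵢ≢Fᵢ)
  ...   | j , Eⱼ⊈Fⱼ , Fⱼ⊈Eⱼ with onChain-comparable (E-covers j) (F-covers j)
  ...     | inj₁ Eⱼ⊆Fⱼ = ⊥-elim (Eⱼ⊈Fⱼ Eⱼ⊆Fⱼ)
  ...     | inj₂ Fⱼ⊆Eⱼ = ⊥-elim (Fⱼ⊈Eⱼ Fⱼ⊆Eⱼ)

  others-uncovered : ∀ {E t} l → E ∈ F' → Covers E t → l ⊆ˡ F' → All (Distinct E) l →
                     coverCount l t ≡ 0
  others-uncovered         []      _    _        _    []                  = refl
  others-uncovered {E} {t} (F ∷ l) E∈F' E-covers l⊆F' ((i , Eᵢ≢Fᵢ) ∷ E≠l) with covers# F t ≟ 0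
  ... | yes F-misses = trans (cong (_+ coverCount l t) F-misses)
                             (others-uncovered l E∈F' E-covers (l⊆F' ∘ there) E≠l)
  ... | no  F-covers =
    ⊥-elim (Eᵢ≢Fᵢ (unique-cover E∈F' (l⊆F' (here refl)) E-covers (covers#≢0 F-covers) i))

  coverCount≤1 : ∀ l → l ⊆ˡ F' → AllPairs Distinct l → ∀ t → coverCount l t ≤ 1
  coverCount≤1 []      _    []               t = z≤n
  coverCount≤1 (E ∷ l) l⊆F' (E≠l ∷ distinct) t with covers# E t ≟ 0
  ... | yes E-misses = subst (_≤ 1) (cong (_+ coverCount l t) (sym E-misses))
                             (coverCount≤1 l (l⊆F' ∘ there) distinct t)
  ... | no  E-covers = begin
    covers# E t + coverCount l t ≡⟨ cong (_+_ (covers# E t)) rest-uncovered ⟩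
    covers# E t + 0              ≡⟨ +-identityʳ _ ⟩
    covers# E t                  ≤⟨ covers#≤1 E t ⟩
    1                            ∎
    where
    open ≤-Reasoning
    rest-uncovered : coverCount l t ≡ 0
    rest-uncovered = others-uncovered l (l⊆F' (here refl)) (covers#≢0 E-covers) (l⊆F' ∘ there) E≠l

  -- Each chain tuple has at most
  -- one cover, and by double counting the numbers of covers add up to
  -- ∑ chainsThrough E, which equals totalChains when the weights sum to 1.
  -- Hence every chain tuple has exactly one cover.
  every-tuple-covered : AllPairs Distinct F' → sumℚ (map weight F') ≡ 1ℚ →
                        ∀ t → ∃ λ E → E ∈ F' × Covers E t
  every-tuple-covered distinct ∑weight≡1 t =
    coverCount≢0 F' t (λ count≡0 → 1+n≢0 (trans (sym (count≡1 t)) count≡0))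
    where
    ∑chainsThrough≡total : sum (map chainsThrough F') ≡ totalChains
    ∑chainsThrough≡total = reciprocals-sum-to-one binomials chainsThrough totalChains
                             binomials*chainsThrough F' ∑weight≡1

    count≡1 : ∀ t → coverCount F' t ≡ 1
    count≡1 = ∑-tight chainTuples (coverCount≤1 F' id distinct)
                (trans (∑-coverCount F') (trans ∑chainsThrough≡total (sym ∑-ones)))

  -- Fix a part i and a member E, and freeze the chains of all other parts
  -- to chains through the traces of E.  The traces on Xᵢ of the members
  -- lying on the frozen chains form a family Gᵢ which, when every chain
  -- tuple is covered, meets each maximal chain of Xᵢ exactly once.
  module AtPart (covered : ∀ t → ∃ λ E → E ∈ F' × Covers E t) (i : Fin M) (E : SubsetX M m) where

    frozen : ChainTuple
    frozen = tuple (λ j → proj₁ (chainThrough (E j)))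

    OnFrozen : SubsetX M m → Set
    OnFrozen F = ∀ j → i ≢ j → OnChain (F j) (get frozen j)

    G : Subset (m i) → Set
    G S = ∃ λ F → F ∈ F' × F i ≡ S × OnFrozen F

    covers-set : ∀ F c → OnChain (F i) c → OnFrozen F → Covers F (set frozen i c)
    covers-set F c Fᵢ∈c F-frozen j with i ≟ᶠ j
    ... | yes refl = subst (OnChain (F i)) (sym (get-set-same frozen i c)) Fᵢ∈c
    ... | no  i≢j  = subst (OnChain (F j)) (sym (get-set-other frozen i c j i≢j)) (F-frozen j i≢j)

    -- Every chain c of Xᵢ meets G: in the trace of a cover of the frozen
    -- tuple with its i-th chain replaced by c.
    at-least-one : ∀ c → ∃ λ S → G S × OnChain S c
    at-least-one c =
      let F , F∈F' , F-covers = covered (set frozen i c)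
          F-frozen j i≢j = subst (OnChain (F j)) (get-set-other frozen i c j i≢j) (F-covers j)
          Fᵢ∈c = subst (OnChain (F i)) (get-set-same frozen i c) (F-covers i)
      in F i , (F , F∈F' , refl , F-frozen) , Fᵢ∈c

    -- Two sets of G on a chain c are traces of covers of the same tuple.
    at-most-one : ∀ {S T c} → G S → G T → OnChain S c → OnChain T c → S ≡ T
    at-most-one {c = c} (F , F∈F' , refl , F-frozen) (F₂ , F₂∈F' , refl , F₂-frozen) Fᵢ∈c F₂ᵢ∈c =
      unique-cover F∈F' F₂∈F' (covers-set F c Fᵢ∈c F-frozen) (covers-set F₂ c F₂ᵢ∈c F₂-frozen) i

    E∈G : E ∈ F' → G (E i)
    E∈G E∈F' = E , E∈F' , refl , λ j _ →
      subst (OnChain (E j)) (sym (get-tuple _ j)) (proj₂ (chainThrough (E j)))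

    open FullLevels G at-most-one at-least-one public using (full-levels)

  full-level-trace : (∀ t → ∃ λ E → E ∈ F' × Covers E t) → ∀ i {E} → E ∈ F' →
                     ∀ S → ∣ S ∣ ≡ ∣ E i ∣ → InTrace F' i S
  full-level-trace covered i {E} E∈F' S |S|≡|Eᵢ| =
    let F , F∈F' , Fᵢ≡S , _ = full-levels (E∈G E∈F') |S|≡|Eᵢ| in F , F∈F' , Fᵢ≡S
    where open AtPart covered i E

theorem4p4 : (M : ℕ) → M ≥ 1 → (m : Fin M → ℕ) → (F' : List (SubsetX M m))
    → AllPairs Distinct F'
    → (∀ E F → E ∈ F' → F ∈ F' → Distinct E F → ∃ λ j → Incomparable (E j) (F j))
    → sumℚ (map weight F') ≡ 1ℚ
    → (i : Fin M) → (q : ℕ)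
    → (∀ (S : Subset (m i)) → ∣ S ∣ ≡ q → InTrace F' i S)
      ⊎ (∀ (S : Subset (m i)) → ∣ S ∣ ≡ q → ¬ InTrace F' i S)
theorem4p4 M _ m F' distinct sperner ∑weight≡1 i q with any? (λ E → ∣ E i ∣ ≟ q) F'
... | no  no-trace-of-size-q = inj₂ λ S |S|≡q (E , E∈F' , Eᵢ≡S) →
  no-trace-of-size-q (lose E∈F' (trans (cong ∣_∣ Eᵢ≡S) |S|≡q))
... | yes some-trace-of-size-q with find some-trace-of-size-q
...   | E , E∈F' , |Eᵢ|≡q = inj₁ λ S |S|≡q →
  full-level-trace (every-tuple-covered distinct ∑weight≡1) i E∈F' S (trans |S|≡q (sym |Eᵢ|≡q))
  where open Sperner F' sperner
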